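{- Let $\mathsf{L}$ be any one of the logics $\mathbf{PD}$, $\mathsf{InqL}$, $\mathbf{PT}$ (defined in the context). Then $\mathsf{L}$ is structurally complete with respect to flat substitutions: for all formulas $\phi,\psi$ in the language of $\mathsf{L}$, if for every flat substitution $\sigma$ of $\mathsf{L}$ we have $\vdash_{\mathsf{L}}\sigma(\phi)\Rightarrow\ \vdash_{\mathsf{L}}\sigma(\psi)$, then $\phi\vdash_{\mathsf{L}}\psi$.
   Context: Fix a countable set $\mathrm{Prop}$ of propositional variables. A valuation is a function $v:\mathrm{Prop}\to\{0,1\}$; a team is a set of valuations. Formulas of $\mathbf{PT}$ are given by $\phi::=p\mid\bot\mid\top\mid {=}(\phi,\dots,\phi,\phi)\mid\neg\phi\mid\phi\wedge\phi\mid\phi\otimes\phi\mid\phi\vee\phi\mid\phi\to\phi$ ($p\in\mathrm{Prop}$). Team semantics: $X\models p$ iff $v(p)=1$ for all $v\in X$; $X\models\bot$ iff $X=\emptyset$; $X\models\top$ always; $X\models\phi\wedge\psi$ iff $X\models\phi$ and $X\models\psi$; $X\models\phi\otimes\psi$ iff $X=Y\cup Z$ for some $Y,Z\subseteq X$ with $Y\models\phi$, $Z\models\psi$; $X\models\phi\vee\psi$ iff $X\models\phi$ or $X\models\psi$; $X\models\phi\to\psi$ iff every $Y\subseteq X$ with $Y\models\phi$ satisfies $Y\models\psi$; $X\models\neg\phi$ iff $\{v\}\not\models\phi$ for all $v\in X$ (equivalently $X\models\phi\to\bot$); $X\models{=}(\phi_1,\dots,\phi_n,\psi)$ iff $X\models\bigwedge_{i=1}^n(\phi_i\vee\neg\phi_i)\to(\psi\vee\neg\psi)$.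 A formula $\phi$ is flat if for every team $X$: $X\models\phi$ iff $\{v\}\models\phi$ for all $v\in X$. Formulas of $\mathbf{PD}$ are given by $\phi::=p\mid\bot\mid\top\mid{=}(\alpha_1,\dots,\alpha_k,\beta)\mid\neg\phi\mid\phi\wedge\phi\mid\phi\otimes\phi$ where $\alpha_i,\beta$ are flat $\mathbf{PD}$-formulas, with the same semantics (for such atoms: $X\models{=}(\vec\alpha,\beta)$ iff for all $v,v'\in X$, if $\{v\}\models\alpha_i\Leftrightarrow\{v'\}\models\alpha_i$ for every $i$, then $\{v\}\models\beta\Leftrightarrow\{v'\}\models\beta$). Formulas of $\mathsf{InqL}$ are built from $p,\bot,\top$ using $\wedge,\vee,\to$ (with $\neg\phi$ abbreviating $\phi\to\bot$), same semantics. For such a logic $\mathsf{L}$ and a finite set $\Gamma$, $\Gamma\vdash_{\mathsf{L}}\phi$ iff $\phi$ and all of $\Gamma$ are in the language of $\mathsf{L}$ and every team satisfying all formulas of $\Gamma$ satisfies $\phi$; $\vdash_{\mathsf{L}}\phi$ means $\emptyset\vdash_{\mathsf{L}}\phi$ (i.e. every team satisfies $\phi$). A substitution of $\mathsf{L}$ is a map from formulas of $\mathsf{L}$ to formulas of $\mathsf{L}$ commuting with all connectives and atoms (e.g. $\sigma(\neg\phi)=\neg\sigma(\phi)$, $\sigma({=}(\vec\phi,\psi))={=}(\sigma(\vec\phi),\sigma(\psi))$, $\sigma(\bot)=\bot$); it is flat if $\sigma(p)$ is flat for every $p\in\mathrm{Prop}$. -}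

module Defs where

open import Level using (Level; Lift; 0ℓ) renaming (suc to lsuc)
open import Data.Nat using (ℕ)
open import Data.Fin using (Fin)
open import Data.Bool using (Bool; true)
open import Data.Unit.Polymorphic using (⊤)
open import Data.Empty using (⊥)
open import Data.Product using (Σ; _×_)
open import Data.Sum using (_⊎_)
open import Relation.Nullary using (¬_)
open import Relation.Binary.PropositionalEquality using (_≡_)

Valuation : Set
Valuation = ℕ → Bool

Team : Set₁
Team = Valuation → Set

_⊆ₜ_ : Team → Team → Set
Y ⊆ₜ X = ∀ v → Y v → X v

-- The singleton team {v} (membership up to pointwise equality of valuations).
single : Valuation → Team
single v w = ∀ n → w n ≡ v n

-- Formulas of PT (the largest language; PD and InqL are sublanguages).
-- dep n as b  is the dependence atom  =(as 0, …, as (n-1), b).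
data Form : Set where
  var    : ℕ → Form
  bot    : Form
  top    : Form
  dep    : (n : ℕ) → (Fin n → Form) → Form → Form
  neg    : Form → Form
  _∧'_   : Form → Form → Form
  _⊗_    : Form → Form → Form
  _∨'_   : Form → Form → Form
  _⇒_    : Form → Form → Form

_⊨_ : Team → Form → Set₁
X ⊨ var p = Lift _ (∀ v → X v → v p ≡ true)
X ⊨ bot = Lift _ (∀ v → X v → ⊥)
X ⊨ top = ⊤
X ⊨ dep n as b =
  ∀ (Y : Team) → Y ⊆ₜ X →
    (∀ i → (Y ⊨ as i) ⊎ (∀ v → Y v → ¬ (single v ⊨ as i))) →
    (Y ⊨ b) ⊎ (∀ v → Y v → ¬ (single v ⊨ b))
X ⊨ neg φ = ∀ v → X v → ¬ (single v ⊨ φ)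
X ⊨ (φ ∧' ψ) = (X ⊨ φ) × (X ⊨ ψ)
X ⊨ (φ ⊗ ψ) =
  Σ Team λ Y → Σ Team λ Z →
    (Y ⊆ₜ X) × (Z ⊆ₜ X) × (∀ v → X v → Y v ⊎ Z v) × (Y ⊨ φ) × (Z ⊨ ψ)
X ⊨ (φ ∨' ψ) = (X ⊨ φ) ⊎ (X ⊨ ψ)
X ⊨ (φ ⇒ ψ) = ∀ (Y : Team) → Y ⊆ₜ X → Y ⊨ φ → Y ⊨ ψ

Flat : Form → Set₁
Flat φ = ∀ (X : Team) → ((X ⊨ φ) → (∀ v → X v → single v ⊨ φ))
                       × ((∀ v → X v → single v ⊨ φ) → (X ⊨ φ))

data Logic : Set where
  PD InqL PT : Logic

data InPD : Form → Set₁ where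
  var : ∀ p → InPD (var p)
  bot : InPD bot
  top : InPD top
  dep : ∀ n as b → (∀ i → InPD (as i) × Flat (as i)) → InPD b → Flat b →
        InPD (dep n as b)
  neg : ∀ {φ} → InPD φ → InPD (neg φ)
  and : ∀ {φ ψ} → InPD φ → InPD ψ → InPD (φ ∧' ψ)
  ten : ∀ {φ ψ} → InPD φ → InPD ψ → InPD (φ ⊗ ψ)

data InInqL : Form → Set where
  var : ∀ p → InInqL (var p)
  bot : InInqL bot
  top : InInqL top
  and : ∀ {φ ψ} → InInqL φ → InInqL ψ → InInqL (φ ∧' ψ)
  or  : ∀ {φ ψ} → InInqL φ → InInqL ψ → InInqL (φ ∨' ψ)
  imp : ∀ {φ ψ} → InInqL φ → InInqL ψ → InInqL (φ ⇒ ψ)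

Lang : Logic → Form → Set₁
Lang PD φ = InPD φ
Lang InqL φ = Lift _ (InInqL φ)
Lang PT φ = ⊤

Subst : Set
Subst = ℕ → Form

sub : Subst → Form → Form
sub σ (var p) = σ p
sub σ bot = bot
sub σ top = top
sub σ (dep n as b) = dep n (λ i → sub σ (as i)) (sub σ b)
sub σ (neg φ) = neg (sub σ φ)
sub σ (φ ∧' ψ) = sub σ φ ∧' sub σ ψ
sub σ (φ ⊗ ψ) = sub σ φ ⊗ sub σ ψ
sub σ (φ ∨' ψ) = sub σ φ ∨' sub σ ψ
sub σ (φ ⇒ ψ) = sub σ φ ⇒ sub σ ψ

IsSubstOf : Logic → Subst → Set₁
IsSubstOf L σ = ∀ φ → Lang L φ → Lang L (sub σ φ)

FlatSubst : Subst → Set₁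
FlatSubst σ = ∀ p → Flat (σ p)

Valid : Logic → Form → Set₁
Valid L φ = Lang L φ × (∀ (X : Team) → X ⊨ φ)

Entails : Logic → Form → Form → Set₁
Entails L φ ψ = Lang L φ × Lang L ψ × (∀ (X : Team) → X ⊨ φ → X ⊨ ψ)

-- Every formula θ is equivalent to the inquisitive disjunction of a finite list NF θ of classical
-- formulas: X ⊨ θ iff X ⊆ ‖e‖ for some e ∈ NF θ; the same holds for σ(θ), σ a flat substitution by
-- classical formulas, with each e read through σ. Given X ⊨ φ, pick such an e. If e is
-- unsatisfiable, X is empty and satisfies ψ. Otherwise fix s ∈ ‖e‖ and substitute
-- σ(p) = (e ∧ p) ∨ (¬e ∧ s(p)): the induced map on valuations sends everything into ‖e‖ and fixes
-- ‖e‖ pointwise. So σ(φ) is valid, hence so is σ(ψ), and on X, where σ acts as the identity, this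
-- gives X ⊨ ψ. In PD, σ preserves flatness of the arguments of dependence atoms because a flat
-- formula's normal form collapses to the single classical formula ⋁ NF θ.

module Submission where

open import Defs
open import Level using (0ℓ; _⊔_; lift; lower) renaming (suc to lsuc)
open import Data.Nat using (ℕ; zero; suc; _<_; _≤_; _≟_; s≤s⁻¹) renaming (_⊔_ to _⊔ℕ_)
open import Data.Nat.Properties using (m≤m⊔n; m≤n⊔m; <-≤-trans; n<1+n; ≤∧≢⇒<)
open import Data.Fin using (Fin; zero; suc)
open import Data.Bool using (Bool; true; false; not; _∧_; _∨_; T; T?)
open import Data.Bool.Properties using (T-∧; T-∨; T-≡; T-not-≡; ∨-identityʳ; not-involutive)
open import Data.Empty using (⊥-elim)
open import Data.Product using (Σ; ∃; _×_; _,_; proj₁; proj₂; uncurry)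
open import Data.Product.Function.NonDependent.Propositional using (_×-⇔_)
open import Data.Sum using (_⊎_; inj₁; inj₂; [_,_]′)
open import Data.Sum.Function.Propositional using (_⊎-⇔_)
open import Data.List using (List; []; _∷_; [_]; _++_; map; cartesianProductWith)
open import Data.List.Relation.Unary.Any using (Any; here; there)
import Data.List.Relation.Unary.Any as Any
open import Data.List.Relation.Unary.Any.Properties
  using (++⁺ˡ; ++⁺ʳ; ++⁻; map⁺; map⁻; singleton⁻; cartesianProductWith⁺; cartesianProductWith⁻)
open import Data.List.Membership.Propositional using (find; lose)
open import Data.List.Membership.Propositional.Properties using (∈-cartesianProductWith⁻)
open import Function using (_∘_; id)
open import Function.Bundles using (_⇔_; mk⇔; Equivalence)
open import Function.Properties.Equivalence using () renaming (trans to ⇔-trans; sym to ⇔-sym)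
open import Relation.Nullary using (¬_; Dec; yes; no)
open import Relation.Nullary.Decidable using (_⊎-dec_; map′)
open import Relation.Binary.PropositionalEquality using (_≡_; _≗_; refl; sym; cong; cong₂; subst)

open Equivalence using (to; from)

variable
  N : ℕ
  b : Bool
  u v w s : Valuation
  X Y Z : Team
  φ ψ : Form

data BExpr : Set where
  bvar         : ℕ → BExpr
  btrue bfalse : BExpr
  bnot         : BExpr → BExpr
  band         : BExpr → BExpr → BExpr

⟦_⟧ : BExpr → Valuation → Bool
⟦ bvar p ⟧ w = w p
⟦ btrue ⟧ w = true
⟦ bfalse ⟧ w = false
⟦ bnot e ⟧ w = not (⟦ e ⟧ w)
⟦ band a b ⟧ w = ⟦ a ⟧ w ∧ ⟦ b ⟧ w

bor : BExpr → BExpr → BExpr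
bor a b = bnot (band (bnot a) (bnot b))

lit : Bool → BExpr
lit true = btrue
lit false = bfalse

⟦bor⟧ : ∀ a b w → ⟦ bor a b ⟧ w ≡ ⟦ a ⟧ w ∨ ⟦ b ⟧ w
⟦bor⟧ a b w with ⟦ a ⟧ w
... | true  = refl
... | false = not-involutive (⟦ b ⟧ w)

⟦lit⟧ : ∀ b w → ⟦ lit b ⟧ w ≡ b
⟦lit⟧ true w = refl
⟦lit⟧ false w = refl

T-not : T (not b) ⇔ (¬ T b)
T-not {true} = mk⇔ (λ ()) (λ ¬t → ¬t _)
T-not {false} = mk⇔ (λ _ ()) (λ _ → _)

T-bor : ∀ a b → T (⟦ bor a b ⟧ w) ⇔ (T (⟦ a ⟧ w) ⊎ T (⟦ b ⟧ w))
T-bor {w} a b = subst (λ x → T x ⇔ (T (⟦ a ⟧ w) ⊎ T (⟦ b ⟧ w))) (sym (⟦bor⟧ a b w)) T-∨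

T-bor-bnot : ∀ a b → T (⟦ bor (bnot a) b ⟧ w) ⇔ (T (⟦ a ⟧ w) → T (⟦ b ⟧ w))
T-bor-bnot {w} a b = mk⇔ elim intro
  where
  elim : T (⟦ bor (bnot a) b ⟧ w) → T (⟦ a ⟧ w) → T (⟦ b ⟧ w)
  elim h ta = [ (λ tna → ⊥-elim (to T-not tna ta)) , id ]′ (to (T-bor (bnot a) b) h)
  intro : (T (⟦ a ⟧ w) → T (⟦ b ⟧ w)) → T (⟦ bor (bnot a) b ⟧ w)
  intro f with T? (⟦ a ⟧ w)
  ... | yes ta = from (T-bor (bnot a) b) (inj₂ (f ta))
  ... | no ¬ta = from (T-bor (bnot a) b) (inj₁ (from T-not ¬ta))

Agree : ℕ → Valuation → Valuation → Set
Agree N u v = ∀ n → n < N → u n ≡ v n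

support : BExpr → ℕ
support (bvar p) = suc p
support btrue = 0
support bfalse = 0
support (bnot e) = support e
support (band a b) = support a ⊔ℕ support b

Agree-≤ : ∀ {M} → M ≤ N → Agree N u v → Agree M u v
Agree-≤ M≤N agree n n<M = agree n (<-≤-trans n<M M≤N)

⟦⟧-local : ∀ e → Agree (support e) u v → ⟦ e ⟧ u ≡ ⟦ e ⟧ v
⟦⟧-local (bvar p) agree = agree p (n<1+n p)
⟦⟧-local btrue _ = refl
⟦⟧-local bfalse _ = refl
⟦⟧-local (bnot e) agree = cong not (⟦⟧-local e agree)
⟦⟧-local (band a b) agree =
  cong₂ _∧_ (⟦⟧-local a (Agree-≤ (m≤m⊔n _ _) agree)) (⟦⟧-local b (Agree-≤ (m≤n⊔m _ _) agree))

⟦⟧-cong : ∀ e → u ≗ v → ⟦ e ⟧ u ≡ ⟦ e ⟧ v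
⟦⟧-cong e u≗v = ⟦⟧-local e (λ n _ → u≗v n)

_[_≔_] : Valuation → ℕ → Bool → Valuation
(v [ N ≔ b ]) n with n ≟ N
... | yes _ = b
... | no  _ = v n

update-Agree : ∀ b → Agree N u v → Agree (suc N) (u [ N ≔ b ]) (v [ N ≔ b ])
update-Agree {N} b agree n n<1+N with n ≟ N
... | yes _   = refl
... | no n≢N = agree n (≤∧≢⇒< (s≤s⁻¹ n<1+N) n≢N)

update-self : ∀ v N → v [ N ≔ v N ] ≗ v
update-self v N n with n ≟ N
... | yes refl = refl
... | no  _    = refl

LocalBelow : ℕ → (Valuation → Bool) → Set
LocalBelow N g = ∀ {u v} → Agree N u v → g u ≡ g v

-- Shannon expansion on the variables below N.
satisfiable-local? : ∀ N g → LocalBelow N g → Dec (∃ λ v → T (g v))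
satisfiable-local? zero g local with T? (g (λ _ → false))
... | yes t = yes (_ , t)
... | no ¬t = no λ (v , t) → ¬t (subst T (local (λ _ ())) t)
satisfiable-local? (suc N) g local =
  map′ join split (at false ⊎-dec at true)
  where
  at : ∀ b → Dec (∃ λ v → T (g (v [ N ≔ b ])))
  at b = satisfiable-local? N (λ v → g (v [ N ≔ b ])) (λ agree → local (update-Agree b agree))
  join : (∃ λ v → T (g (v [ N ≔ false ]))) ⊎ (∃ λ v → T (g (v [ N ≔ true ]))) → ∃ λ v → T (g v)
  join (inj₁ (_ , t)) = _ , t
  join (inj₂ (_ , t)) = _ , t
  split : (∃ λ v → T (g v)) → (∃ λ v → T (g (v [ N ≔ false ]))) ⊎ (∃ λ v → T (g (v [ N ≔ true ])))
  split (v , t) = by-value (v N) (subst T (sym (local (λ n _ → update-self v N n))) t)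
    where
    by-value : ∀ b → T (g (v [ N ≔ b ])) →
               (∃ λ v → T (g (v [ N ≔ false ]))) ⊎ (∃ λ v → T (g (v [ N ≔ true ])))
    by-value false t = inj₁ (v , t)
    by-value true  t = inj₂ (v , t)

satisfiable? : ∀ e → Dec (∃ λ v → T (⟦ e ⟧ v))
satisfiable? e = satisfiable-local? (support e) ⟦ e ⟧ (⟦⟧-local e)

⌊_⌋ : (Valuation → Bool) → Team
⌊ g ⌋ w = T (g w)

_∩_ : Team → Team → Team
(X ∩ Y) w = X w × Y w

Respects≗ : (Valuation → Bool) → Set
Respects≗ g = ∀ {u v} → u ≗ v → g u ≡ g v

Represents : Form → (Valuation → Bool) → Set₁
Represents φ g = ∀ Y → (Y ⊨ φ) ⇔ (Y ⊆ₜ ⌊ g ⌋)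

module _ {g : Valuation → Bool} where

  Represents-single : Respects≗ g → Represents φ g → (single v ⊨ φ) ⇔ T (g v)
  Represents-single {v = v} g-cong rep = mk⇔
    (λ h → to (rep (single v)) h v (λ _ → refl))
    (λ t → from (rep (single v)) (λ u u≗v → subst T (sym (g-cong u≗v)) t))

  Represents⇒Flat : Respects≗ g → Represents φ g → Flat φ
  Represents⇒Flat g-cong rep X =
    (λ h v Xv → from (Represents-single g-cong rep) (to (rep X) h v Xv)) ,
    (λ k → from (rep X) (λ v Xv → to (Represents-single g-cong rep) (k v Xv)))

Represents-var : ∀ p → Represents (var p) (λ w → w p)
Represents-var p Y = mk⇔ (λ h w Yw → from T-≡ (lower h w Yw)) (λ h → lift (λ w Yw → to T-≡ (h w Yw)))

Represents-top : Represents top (λ _ → true)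
Represents-top Y = mk⇔ _ _

Represents-bot : Represents bot (λ _ → false)
Represents-bot Y = mk⇔ lower lift

Represents-∧ : ∀ {g h} → Represents φ g → Represents ψ h → Represents (φ ∧' ψ) (λ w → g w ∧ h w)
Represents-∧ repφ repψ Y = ⇔-trans (repφ Y ×-⇔ repψ Y) (mk⇔
  (λ (Y⊆g , Y⊆h) w Yw → from T-∧ (Y⊆g w Yw , Y⊆h w Yw))
  (λ Y⊆g∧h → (λ w Yw → proj₁ (to T-∧ (Y⊆g∧h w Yw))) , (λ w Yw → proj₂ (to T-∧ (Y⊆g∧h w Yw)))))

Represents-neg : ∀ {g} → Respects≗ g → Represents φ g → Represents (neg φ) (not ∘ g)
Represents-neg g-cong rep Y = mk⇔
  (λ h w Yw → from T-not (h w Yw ∘ from (Represents-single g-cong rep)))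
  (λ h w Yw → to T-not (h w Yw) ∘ to (Represents-single g-cong rep))

Represents-⇒bot : ∀ {g} → Represents φ g → Represents (φ ⇒ bot) (not ∘ g)
Represents-⇒bot {g = g} rep Y = mk⇔
  (λ h w Yw → from T-not λ t → lower (h (Y ∩ ⌊ g ⌋) (λ _ → proj₁) (from (rep _) (λ _ → proj₂))) w (Yw , t))
  (λ h Z Z⊆Y Zφ → lift λ w Zw → to T-not (h w (Z⊆Y w Zw)) (to (rep Z) Zφ w Zw))

¬[_] : Logic → Form → Form
¬[ InqL ] φ = φ ⇒ bot
¬[ PD ] φ = neg φ
¬[ PT ] φ = neg φ

encode : Logic → BExpr → Form
encode L (bvar p) = var p
encode L btrue = top
encode L bfalse = bot
encode L (bnot e) = ¬[ L ] (encode L e)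
encode L (band a b) = encode L a ∧' encode L b

¬[]-represents : ∀ L {g} → Respects≗ g → Represents φ g → Represents (¬[ L ] φ) (not ∘ g)
¬[]-represents InqL _ = Represents-⇒bot
¬[]-represents PD = Represents-neg
¬[]-represents PT = Represents-neg

encode-represents : ∀ L e → Represents (encode L e) ⟦ e ⟧
encode-represents L (bvar p) = Represents-var p
encode-represents L btrue = Represents-top
encode-represents L bfalse = Represents-bot
encode-represents L (bnot e) = ¬[]-represents L (⟦⟧-cong e) (encode-represents L e)
encode-represents L (band a b) = Represents-∧ (encode-represents L a) (encode-represents L b)

encode-InPD : ∀ e → InPD (encode PD e)
encode-InPD (bvar p) = var p
encode-InPD btrue = top
encode-InPD bfalse = bot
encode-InPD (bnot e) = neg (encode-InPD e)
encode-InPD (band a b) = and (encode-InPD a) (encode-InPD b)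

encode-InInqL : ∀ e → InInqL (encode InqL e)
encode-InInqL (bvar p) = var p
encode-InInqL btrue = top
encode-InInqL bfalse = bot
encode-InInqL (bnot e) = imp (encode-InInqL e) bot
encode-InInqL (band a b) = and (encode-InInqL a) (encode-InInqL b)

module _ {σ : Subst} where

  sub-InInqL : (∀ p → InInqL (σ p)) → ∀ {θ} → InInqL θ → InInqL (sub σ θ)
  sub-InInqL σ∈ (var p) = σ∈ p
  sub-InInqL σ∈ bot = bot
  sub-InInqL σ∈ top = top
  sub-InInqL σ∈ (and i j) = and (sub-InInqL σ∈ i) (sub-InInqL σ∈ j)
  sub-InInqL σ∈ (or i j) = or (sub-InInqL σ∈ i) (sub-InInqL σ∈ j)
  sub-InInqL σ∈ (imp i j) = imp (sub-InInqL σ∈ i) (sub-InInqL σ∈ j)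

  sub-InPD : (∀ p → InPD (σ p)) → (∀ {a} → Flat a → Flat (sub σ a)) → ∀ {θ} → InPD θ → InPD (sub σ θ)
  sub-InPD σ∈ flat (var p) = σ∈ p
  sub-InPD σ∈ flat bot = bot
  sub-InPD σ∈ flat top = top
  sub-InPD σ∈ flat (dep n as b as∈ b∈ b-flat) =
    dep n _ _ (λ i → sub-InPD σ∈ flat (proj₁ (as∈ i)) , flat (proj₂ (as∈ i)))
      (sub-InPD σ∈ flat b∈) (flat b-flat)
  sub-InPD σ∈ flat (neg i) = neg (sub-InPD σ∈ flat i)
  sub-InPD σ∈ flat (and i j) = and (sub-InPD σ∈ flat i) (sub-InPD σ∈ flat j)
  sub-InPD σ∈ flat (ten i j) = ten (sub-InPD σ∈ flat i) (sub-InPD σ∈ flat j)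

variable
  A B : List BExpr
  ρ ρ′ : ℕ → BExpr

⟦_⟧ˢ : (ℕ → BExpr) → Valuation → Valuation
⟦ ρ ⟧ˢ w p = ⟦ ρ p ⟧ w

⟦⟧ˢ-cong : ∀ ρ → u ≗ v → ⟦ ρ ⟧ˢ u ≗ ⟦ ρ ⟧ˢ v
⟦⟧ˢ-cong ρ u≗v p = ⟦⟧-cong (ρ p) u≗v

⋁ : List BExpr → BExpr
⋁ [] = bfalse
⋁ (e ∷ A) = bor e (⋁ A)

T-⋁ : ∀ A → T (⟦ ⋁ A ⟧ w) ⇔ Any (λ e → T (⟦ e ⟧ w)) A
T-⋁ [] = mk⇔ (λ ()) (λ ())
T-⋁ (e ∷ A) = ⇔-trans (T-bor e (⋁ A)) (mk⇔
  [ here , there ∘ to (T-⋁ A) ]′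
  (λ { (here t) → inj₁ t ; (there t) → inj₂ (from (T-⋁ A) t) }))

infixr 6 _∧ᴺ_ _⊗ᴺ_
infixr 5 _⇒ᴺ_
infix 7 ¬ᴺ_
infix 4 _⊨[_]_ _≈[_]_

_∧ᴺ_ _⊗ᴺ_ _⇒ᴺ_ : List BExpr → List BExpr → List BExpr
A ∧ᴺ B = cartesianProductWith band A B
A ⊗ᴺ B = cartesianProductWith bor A B
[] ⇒ᴺ B = [ btrue ]
(a ∷ A) ⇒ᴺ B = map (bor (bnot a)) B ∧ᴺ (A ⇒ᴺ B)

¬ᴺ_ : List BExpr → List BExpr
¬ᴺ A = [ bnot (⋁ A) ]

⋀ᴺ : ∀ n → (Fin n → List BExpr) → List BExpr
⋀ᴺ zero G = [ btrue ]
⋀ᴺ (suc n) G = G zero ∧ᴺ ⋀ᴺ n (G ∘ suc)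

NF : Form → List BExpr
NF (var p) = [ bvar p ]
NF bot = [ bfalse ]
NF top = [ btrue ]
NF (dep n as b) = ⋀ᴺ n (λ i → NF (as i) ++ ¬ᴺ NF (as i)) ⇒ᴺ (NF b ++ ¬ᴺ NF b)
NF (neg φ) = ¬ᴺ NF φ
NF (φ ∧' ψ) = NF φ ∧ᴺ NF ψ
NF (φ ⊗ ψ) = NF φ ⊗ᴺ NF ψ
NF (φ ∨' ψ) = NF φ ++ NF ψ
NF (φ ⇒ ψ) = NF φ ⇒ᴺ NF ψ

_⊨[_]_ : Team → (ℕ → BExpr) → List BExpr → Set
Y ⊨[ ρ ] A = Any (λ e → Y ⊆ₜ ⌊ ⟦ e ⟧ ∘ ⟦ ρ ⟧ˢ ⌋) A

record _≈[_]_ (φ : Form) (ρ : ℕ → BExpr) (A : List BExpr) : Set₁ where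
  constructor mk≈
  field equiv : ∀ Y → (Y ⊨ φ) ⇔ (Y ⊨[ ρ ] A)

open _≈[_]_

-- By definition  X ⊨ φ ⊗ ψ = Split (_⊨ φ) (_⊨ ψ) X,  X ⊨ φ ⇒ ψ = Implies (_⊨ φ) (_⊨ ψ) X  and
-- X ⊨ dep n as b = Implies (λ Z → ∀ i → Z ⊨ (as i ∨' neg (as i))) (_⊨ (b ∨' neg b)) X.
Split : ∀ {a b} → (Team → Set a) → (Team → Set b) → Team → Set (lsuc 0ℓ ⊔ a ⊔ b)
Split P Q X = Σ Team λ Y → Σ Team λ Z → (Y ⊆ₜ X) × (Z ⊆ₜ X) × (∀ v → X v → Y v ⊎ Z v) × P Y × Q Z

Implies : ∀ {a b} → (Team → Set a) → (Team → Set b) → Team → Set (lsuc 0ℓ ⊔ a ⊔ b)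
Implies P Q Y = ∀ Z → Z ⊆ₜ Y → P Z → Q Z

module _ {a b c d} {P : Team → Set a} {P′ : Team → Set b} {Q : Team → Set c} {Q′ : Team → Set d}
         (P⇔P′ : ∀ Y → P Y ⇔ P′ Y) (Q⇔Q′ : ∀ Y → Q Y ⇔ Q′ Y) where

  Split-cong : Split P Q X ⇔ Split P′ Q′ X
  Split-cong = mk⇔
    (λ (Y , Z , Y⊆X , Z⊆X , cover , PY , QZ) → Y , Z , Y⊆X , Z⊆X , cover , to (P⇔P′ Y) PY , to (Q⇔Q′ Z) QZ)
    (λ (Y , Z , Y⊆X , Z⊆X , cover , PY , QZ) → Y , Z , Y⊆X , Z⊆X , cover , from (P⇔P′ Y) PY , from (Q⇔Q′ Z) QZ)

  Implies-cong : Implies P Q Y ⇔ Implies P′ Q′ Y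
  Implies-cong = mk⇔
    (λ h Z Z⊆Y → to (Q⇔Q′ Z) ∘ h Z Z⊆Y ∘ from (P⇔P′ Z))
    (λ h Z Z⊆Y → from (Q⇔Q′ Z) ∘ h Z Z⊆Y ∘ to (P⇔P′ Z))

module NormalForm (ρ : ℕ → BExpr) where

  ⊨[]-mono : Z ⊆ₜ Y → Y ⊨[ ρ ] A → Z ⊨[ ρ ] A
  ⊨[]-mono Z⊆Y = Any.map (λ Y⊆e w Zw → Y⊆e w (Z⊆Y w Zw))

  ⊨[]-single : single v ⊨[ ρ ] A ⇔ T (⟦ ⋁ A ⟧ (⟦ ρ ⟧ˢ v))
  ⊨[]-single {A = A} = ⇔-trans
    (mk⇔ (Any.map (λ h → h _ (λ _ → refl)))
         (Any.map (λ {e} t u u≗v → subst T (sym (⟦⟧-cong e (⟦⟧ˢ-cong ρ u≗v))) t)))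
    (⇔-sym (T-⋁ A))

  ⊨[]-++ : Y ⊨[ ρ ] (A ++ B) ⇔ (Y ⊨[ ρ ] A ⊎ Y ⊨[ ρ ] B)
  ⊨[]-++ {A = A} = mk⇔ (++⁻ A) [ ++⁺ˡ , ++⁺ʳ A ]′

  ⊨[]-¬ᴺ : Y ⊨[ ρ ] (¬ᴺ A) ⇔ (∀ w → Y w → ¬ T (⟦ ⋁ A ⟧ (⟦ ρ ⟧ˢ w)))
  ⊨[]-¬ᴺ = mk⇔ (λ { (here h) w Yw → to T-not (h w Yw) }) (λ h → here (λ w Yw → from T-not (h w Yw)))

  ⊨[]-∧ᴺ : Y ⊨[ ρ ] (A ∧ᴺ B) ⇔ (Y ⊨[ ρ ] A × Y ⊨[ ρ ] B)
  ⊨[]-∧ᴺ {A = A} {B} = mk⇔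
    (cartesianProductWith⁻ band (λ h → (λ w Yw → proj₁ (to T-∧ (h w Yw))) , (λ w Yw → proj₂ (to T-∧ (h w Yw)))) A B)
    (uncurry (cartesianProductWith⁺ band (λ ha hb w Yw → from T-∧ (ha w Yw , hb w Yw))))

  ⊨[]-⋀ᴺ : ∀ n {G} → Y ⊨[ ρ ] ⋀ᴺ n G ⇔ (∀ i → Y ⊨[ ρ ] G i)
  ⊨[]-⋀ᴺ zero = mk⇔ (λ _ ()) (λ _ → here (λ _ _ → _))
  ⊨[]-⋀ᴺ (suc n) = ⇔-trans ⊨[]-∧ᴺ (mk⇔
    (λ (h₀ , hₛ) → λ { zero → h₀ ; (suc i) → to (⊨[]-⋀ᴺ n) hₛ i })
    (λ h → h zero , from (⊨[]-⋀ᴺ n) (h ∘ suc)))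

  ⊨[]-⊗ᴺ : Y ⊨[ ρ ] (A ⊗ᴺ B) ⇔ Split (_⊨[ ρ ] A) (_⊨[ ρ ] B) Y
  ⊨[]-⊗ᴺ {Y} {A} {B} = mk⇔ split join
    where
    split : Y ⊨[ ρ ] (A ⊗ᴺ B) → Split (_⊨[ ρ ] A) (_⊨[ ρ ] B) Y
    split h with find h
    ... | e , e∈ , Y⊆e with ∈-cartesianProductWith⁻ bor A B e∈
    ... | a , b , a∈ , b∈ , refl =
      Y ∩ ⌊ ⟦ a ⟧ ∘ ⟦ ρ ⟧ˢ ⌋ , Y ∩ ⌊ ⟦ b ⟧ ∘ ⟦ ρ ⟧ˢ ⌋ , (λ _ → proj₁) , (λ _ → proj₁) ,
      (λ w Yw → [ inj₁ ∘ (Yw ,_) , inj₂ ∘ (Yw ,_) ]′ (to (T-bor a b) (Y⊆e w Yw))) ,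
      lose a∈ (λ _ → proj₂) , lose b∈ (λ _ → proj₂)
    join : Split (_⊨[ ρ ] A) (_⊨[ ρ ] B) Y → Y ⊨[ ρ ] (A ⊗ᴺ B)
    join (Y₁ , Z₁ , _ , _ , cover , hA , hB) = cartesianProductWith⁺ bor
      (λ {a} {b} Y₁⊆a Z₁⊆b w Yw → from (T-bor a b) ([ inj₁ ∘ Y₁⊆a w , inj₂ ∘ Z₁⊆b w ]′ (cover w Yw)))
      hA hB

  ⊨[]-relativize : ∀ a B → Y ⊨[ ρ ] map (bor (bnot a)) B ⇔ (Y ∩ ⌊ ⟦ a ⟧ ∘ ⟦ ρ ⟧ˢ ⌋) ⊨[ ρ ] B
  ⊨[]-relativize a B = mk⇔
    (Any.map (λ {b} h w (Yw , ta) → to (T-bor-bnot a b) (h w Yw) ta) ∘ map⁻)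
    (map⁺ ∘ Any.map (λ {b} h w Yw → from (T-bor-bnot a b) (λ ta → h w (Yw , ta))))

  ⊨[]-⇒ᴺ : ∀ A → Y ⊨[ ρ ] (A ⇒ᴺ B) ⇔ Implies (_⊨[ ρ ] A) (_⊨[ ρ ] B) Y
  ⊨[]-⇒ᴺ [] = mk⇔ (λ _ _ _ ()) (λ _ → here (λ _ _ → _))
  ⊨[]-⇒ᴺ {Y} {B} (a ∷ A) = ⇔-trans ⊨[]-∧ᴺ (⇔-trans (⊨[]-relativize a B ×-⇔ ⊨[]-⇒ᴺ A) (mk⇔ join split))
    where
    Ya : Team
    Ya = Y ∩ ⌊ ⟦ a ⟧ ∘ ⟦ ρ ⟧ˢ ⌋
    join : Ya ⊨[ ρ ] B × Implies (_⊨[ ρ ] A) (_⊨[ ρ ] B) Y → Implies (_⊨[ ρ ] (a ∷ A)) (_⊨[ ρ ] B) Y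
    join (hB , _) Z Z⊆Y (here Z⊆a) = ⊨[]-mono (λ w Zw → Z⊆Y w Zw , Z⊆a w Zw) hB
    join (_ , hA) Z Z⊆Y (there ZA) = hA Z Z⊆Y ZA
    split : Implies (_⊨[ ρ ] (a ∷ A)) (_⊨[ ρ ] B) Y → Ya ⊨[ ρ ] B × Implies (_⊨[ ρ ] A) (_⊨[ ρ ] B) Y
    split H = H Ya (λ _ → proj₁) (here (λ _ → proj₂)) , (λ Z Z⊆Y ZA → H Z Z⊆Y (there ZA))

  ≈-represents : ∀ e → Represents φ (⟦ e ⟧ ∘ ⟦ ρ ⟧ˢ) → φ ≈[ ρ ] [ e ]
  ≈-represents e rep = mk≈ λ Y → ⇔-trans (rep Y) (mk⇔ here singleton⁻)

  ≈-single : φ ≈[ ρ ] A → (single v ⊨ φ) ⇔ T (⟦ ⋁ A ⟧ (⟦ ρ ⟧ˢ v))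
  ≈-single φ≈A = ⇔-trans (equiv φ≈A _) ⊨[]-single

  ≈-neg : φ ≈[ ρ ] A → neg φ ≈[ ρ ] ¬ᴺ A
  ≈-neg φ≈A = mk≈ λ Y → ⇔-trans
    (mk⇔ (λ h w Yw → h w Yw ∘ from (≈-single φ≈A)) (λ h w Yw → h w Yw ∘ to (≈-single φ≈A)))
    (⇔-sym ⊨[]-¬ᴺ)

  ≈-∧ : φ ≈[ ρ ] A → ψ ≈[ ρ ] B → (φ ∧' ψ) ≈[ ρ ] (A ∧ᴺ B)
  ≈-∧ φ≈A ψ≈B = mk≈ λ Y → ⇔-trans (equiv φ≈A Y ×-⇔ equiv ψ≈B Y) (⇔-sym ⊨[]-∧ᴺ)

  ≈-∨ : φ ≈[ ρ ] A → ψ ≈[ ρ ] B → (φ ∨' ψ) ≈[ ρ ] (A ++ B)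
  ≈-∨ φ≈A ψ≈B = mk≈ λ Y → ⇔-trans (equiv φ≈A Y ⊎-⇔ equiv ψ≈B Y) (⇔-sym ⊨[]-++)

  ≈-⊗ : φ ≈[ ρ ] A → ψ ≈[ ρ ] B → (φ ⊗ ψ) ≈[ ρ ] (A ⊗ᴺ B)
  ≈-⊗ φ≈A ψ≈B = mk≈ λ Y → ⇔-trans (Split-cong (equiv φ≈A) (equiv ψ≈B)) (⇔-sym ⊨[]-⊗ᴺ)

  ≈-⇒ : φ ≈[ ρ ] A → ψ ≈[ ρ ] B → (φ ⇒ ψ) ≈[ ρ ] (A ⇒ᴺ B)
  ≈-⇒ {A = A} φ≈A ψ≈B = mk≈ λ Y → ⇔-trans (Implies-cong (equiv φ≈A) (equiv ψ≈B)) (⇔-sym (⊨[]-⇒ᴺ A))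

  ≈-dep : ∀ n {as : Fin n → Form} {b} {G : Fin n → List BExpr} → (∀ i → as i ≈[ ρ ] G i) → b ≈[ ρ ] B →
          dep n as b ≈[ ρ ] (⋀ᴺ n (λ i → G i ++ ¬ᴺ G i) ⇒ᴺ (B ++ ¬ᴺ B))
  ≈-dep n {as} {b} {G} as≈G b≈B = mk≈ λ Y → ⇔-trans
    (Implies-cong antecedents (equiv (≈-∨ b≈B (≈-neg b≈B))))
    (⇔-sym (⊨[]-⇒ᴺ (⋀ᴺ n (λ i → G i ++ ¬ᴺ G i))))
    where
    decided : ∀ i → (as i ∨' neg (as i)) ≈[ ρ ] (G i ++ ¬ᴺ G i)
    decided i = ≈-∨ (as≈G i) (≈-neg (as≈G i))
    antecedents : ∀ Z → (∀ i → Z ⊨ (as i ∨' neg (as i))) ⇔ (Z ⊨[ ρ ] ⋀ᴺ n (λ i → G i ++ ¬ᴺ G i))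
    antecedents Z = ⇔-trans
      (mk⇔ (λ h i → to (equiv (decided i) Z) (h i)) (λ h i → from (equiv (decided i) Z) (h i)))
      (⇔-sym (⊨[]-⋀ᴺ n))

module _ where
  open NormalForm bvar

  ⊨⇔NF : ∀ θ → θ ≈[ bvar ] NF θ
  ⊨⇔NF (var p) = ≈-represents (bvar p) (Represents-var p)
  ⊨⇔NF bot = ≈-represents bfalse Represents-bot
  ⊨⇔NF top = ≈-represents btrue Represents-top
  ⊨⇔NF (dep n as b) = ≈-dep n (λ i → ⊨⇔NF (as i)) (⊨⇔NF b)
  ⊨⇔NF (neg φ) = ≈-neg (⊨⇔NF φ)
  ⊨⇔NF (φ ∧' ψ) = ≈-∧ (⊨⇔NF φ) (⊨⇔NF ψ)
  ⊨⇔NF (φ ⊗ ψ) = ≈-⊗ (⊨⇔NF φ) (⊨⇔NF ψ)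
  ⊨⇔NF (φ ∨' ψ) = ≈-∨ (⊨⇔NF φ) (⊨⇔NF ψ)
  ⊨⇔NF (φ ⇒ ψ) = ≈-⇒ (⊨⇔NF φ) (⊨⇔NF ψ)

module _ {σ : Subst} (ρ : ℕ → BExpr) (σ-rep : ∀ p → Represents (σ p) ⟦ ρ p ⟧) where
  open NormalForm ρ

  sub⇔NF : ∀ θ → sub σ θ ≈[ ρ ] NF θ
  sub⇔NF (var p) = ≈-represents (bvar p) (σ-rep p)
  sub⇔NF bot = ≈-represents bfalse Represents-bot
  sub⇔NF top = ≈-represents btrue Represents-top
  sub⇔NF (dep n as b) = ≈-dep n (λ i → sub⇔NF (as i)) (sub⇔NF b)
  sub⇔NF (neg φ) = ≈-neg (sub⇔NF φ)
  sub⇔NF (φ ∧' ψ) = ≈-∧ (sub⇔NF φ) (sub⇔NF ψ)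
  sub⇔NF (φ ⊗ ψ) = ≈-⊗ (sub⇔NF φ) (sub⇔NF ψ)
  sub⇔NF (φ ∨' ψ) = ≈-∨ (sub⇔NF φ) (sub⇔NF ψ)
  sub⇔NF (φ ⇒ ψ) = ≈-⇒ (sub⇔NF φ) (sub⇔NF ψ)

-- Flatness applied to the team ⌊ ⟦ ⋁ A ⟧ ⌋ yields one disjunct of A covering all of ⋁ A.
⋁-collapse : Flat φ → φ ≈[ bvar ] A → ∀ ρ Y → (Y ⊨[ ρ ] A) ⇔ (Y ⊆ₜ ⌊ ⟦ ⋁ A ⟧ ∘ ⟦ ρ ⟧ˢ ⌋)
⋁-collapse {φ = φ} {A = A} flat φ≈A ρ Y = mk⇔
  (λ h w Yw → from (T-⋁ A) (Any.map (λ Y⊆e → Y⊆e w Yw) h))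
  (λ Y⊆⋁ → Any.map (λ ⋁A⊆e w Yw → ⋁A⊆e _ (Y⊆⋁ w Yw)) (to (equiv φ≈A ⌊ ⟦ ⋁ A ⟧ ⌋) ⋁A⊨φ))
  where
  ⋁A⊨φ : ⌊ ⟦ ⋁ A ⟧ ⌋ ⊨ φ
  ⋁A⊨φ = proj₂ (flat _) (λ u → from (NormalForm.≈-single bvar φ≈A))

sub-Flat : ∀ {σ} ρ → (∀ p → Represents (σ p) ⟦ ρ p ⟧) → ∀ {a} → Flat a → Flat (sub σ a)
sub-Flat ρ σ-rep {a} flat = Represents⇒Flat
  (λ u≗v → ⟦⟧-cong (⋁ (NF a)) (⟦⟧ˢ-cong ρ u≗v))
  (λ Y → ⇔-trans (equiv (sub⇔NF ρ σ-rep a) Y) (⋁-collapse flat (⊨⇔NF a) ρ Y))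

encode-IsSubstOf : ∀ L ρ → IsSubstOf L (encode L ∘ ρ)
encode-IsSubstOf PD ρ _ = sub-InPD (encode-InPD ∘ ρ) (sub-Flat ρ (encode-represents PD ∘ ρ))
encode-IsSubstOf InqL ρ _ (lift θ∈) = lift (sub-InInqL (encode-InInqL ∘ ρ) θ∈)
encode-IsSubstOf PT ρ _ _ = _

encode-FlatSubst : ∀ L ρ → FlatSubst (encode L ∘ ρ)
encode-FlatSubst L ρ p = Represents⇒Flat (⟦⟧-cong (ρ p)) (encode-represents L (ρ p))

-- A retraction of all valuations onto ⌊ ⟦ e ⟧ ⌋ when s lies in it.
retract : BExpr → Valuation → ℕ → BExpr
retract e s p = bor (band e (bvar p)) (band (bnot e) (lit (s p)))

retract-fixes : ∀ e s → T (⟦ e ⟧ w) → ⟦ retract e s ⟧ˢ w ≗ w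
retract-fixes {w} e s t p
  rewrite ⟦bor⟧ (band e (bvar p)) (band (bnot e) (lit (s p))) w | to T-≡ t = ∨-identityʳ (w p)

retract-resets : ∀ e s → ¬ T (⟦ e ⟧ w) → ⟦ retract e s ⟧ˢ w ≗ s
retract-resets {w} e s ¬t p
  rewrite ⟦bor⟧ (band e (bvar p)) (band (bnot e) (lit (s p))) w | to T-not-≡ (from T-not ¬t) = ⟦lit⟧ (s p) w

retract-into : ∀ e s → T (⟦ e ⟧ s) → T (⟦ e ⟧ (⟦ retract e s ⟧ˢ w))
retract-into {w} e s es with T? (⟦ e ⟧ w)
... | yes t = subst T (sym (⟦⟧-cong e (retract-fixes e s t))) t
... | no ¬t = subst T (sym (⟦⟧-cong e (retract-resets e s ¬t))) es

⊨-empty : ∀ θ → (∀ w → ¬ X w) → X ⊨ θ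
⊨-empty (var p) empty = lift (λ w Xw → ⊥-elim (empty w Xw))
⊨-empty bot empty = lift empty
⊨-empty top empty = _
⊨-empty (dep n as b) empty = λ Y Y⊆X _ → inj₁ (⊨-empty b (λ w Yw → empty w (Y⊆X w Yw)))
⊨-empty (neg φ) empty = λ w Xw _ → empty w Xw
⊨-empty (φ ∧' ψ) empty = ⊨-empty φ empty , ⊨-empty ψ empty
⊨-empty {X} (φ ⊗ ψ) empty = X , X , (λ _ Xw → Xw) , (λ _ Xw → Xw) , (λ _ → inj₁) , ⊨-empty φ empty , ⊨-empty ψ empty
⊨-empty (φ ∨' ψ) empty = inj₁ (⊨-empty φ empty)
⊨-empty (φ ⇒ ψ) empty = λ Y Y⊆X _ → ⊨-empty ψ (λ w Yw → empty w (Y⊆X w Yw))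

⊨[]-cong : ∀ ρ ρ′ → (∀ w → Y w → ⟦ ρ ⟧ˢ w ≗ ⟦ ρ′ ⟧ˢ w) → Y ⊨[ ρ ] A → Y ⊨[ ρ′ ] A
⊨[]-cong ρ ρ′ ρ≗ρ′ = Any.map (λ {e} Y⊆e w Yw → subst T (⟦⟧-cong e (ρ≗ρ′ w Yw)) (Y⊆e w Yw))

theorem5p4 : ∀ (L : Logic) (φ ψ : Form) → Lang L φ → Lang L ψ →
    (∀ (σ : Subst) → IsSubstOf L σ → FlatSubst σ →
       Valid L (sub σ φ) → Valid L (sub σ ψ)) →
    Entails L φ ψ
theorem5p4 L φ ψ Lφ Lψ H = Lφ , Lψ , entails
  where
  entails : ∀ X → X ⊨ φ → X ⊨ ψ
  entails X X⊨φ with find (to (equiv (⊨⇔NF φ) X) X⊨φ)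
  ... | e , e∈NFφ , X⊆e with satisfiable? e
  ...   | no unsat = ⊨-empty ψ (λ w Xw → unsat (w , X⊆e w Xw))
  ...   | yes (s , es) = from (equiv (⊨⇔NF ψ) X) (⊨[]-cong ρₑ bvar (λ w Xw → retract-fixes e s (X⊆e w Xw)) X⊨ψ̂)
    where
    ρₑ : ℕ → BExpr
    ρₑ = retract e s
    σₑ : Subst
    σₑ = encode L ∘ ρₑ
    ⊢σφ : Valid L (sub σₑ φ)
    ⊢σφ = encode-IsSubstOf L ρₑ φ Lφ ,
          λ Y → from (equiv (sub⇔NF ρₑ (encode-represents L ∘ ρₑ) φ) Y) (lose e∈NFφ (λ _ _ → retract-into e s es))
    X⊨ψ̂ : X ⊨[ ρₑ ] NF ψ
    X⊨ψ̂ = to (equiv (sub⇔NF ρₑ (encode-represents L ∘ ρₑ) ψ) X)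
             (proj₂ (H σₑ (encode-IsSubstOf L ρₑ) (encode-FlatSubst L ρₑ) ⊢σφ) X)
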